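{- Let $G=(V,E)$ be a connected graph with an articulation vertex $u$ that subdivides $G$ into two subgraphs $G_1$ and $G_2$, both containing $u$. If there exists a minimum vertex cover $C_1$ of $G_1$ with $u\in C_1$, then $G$ is VC-reducible.
   Context: A vertex cover is a set of vertices meeting every edge. "$u$ subdivides $G$ into $G_1$ and $G_2$" means $G_1,G_2$ are subgraphs with $V(G_1)\cup V(G_2)=V$, $V(G_1)\cap V(G_2)=\{u\}$, $E(G_1)\cup E(G_2)=E$, $E(G_1)\cap E(G_2)=\emptyset$, each containing a vertex other than $u$. A connected graph $G=(V,E)$ is VC-irreducible if for every edge $e\in E$ the graph $(V,E\setminus\{e\})$ has strictly smaller minimum vertex cover size than $G$; it is VC-reducible if it is connected and not VC-irreducible. -}

module Defs where

open import Data.Nat using (ℕ; _≤_; _<_)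
open import Data.Fin using (Fin; _≟_)
open import Data.Fin.Subset using (Subset; _∈_; ∣_∣)
open import Data.Product using (Σ; ∃; ∃-syntax; _×_; _,_)
open import Data.Sum using (_⊎_; inj₁; inj₂)
open import Data.Empty using (⊥)
open import Relation.Nullary using (¬_; Dec; yes; no)
open import Relation.Nullary.Decidable using (_×-dec_; _⊎-dec_; ¬?)
open import Relation.Binary.PropositionalEquality using (_≡_; _≢_)

-- A finite simple graph on vertex set Fin n: decidable, symmetric,
-- irreflexive adjacency relation.  An (undirected) edge {x,y} is Adj x y.
record Graph (n : ℕ) : Set₁ where
  field
    Adj    : Fin n → Fin n → Set
    sym    : ∀ {x y} → Adj x y → Adj y x
    irrefl : ∀ {x} → Adj x x → ⊥
    dec    : ∀ x y → Dec (Adj x y)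
open Graph public

data Reach {n : ℕ} (G : Graph n) : Fin n → Fin n → Set where
  here : ∀ {x} → Reach G x x
  step : ∀ {x y z} → Adj G x y → Reach G y z → Reach G x z

Connected : ∀ {n} → Graph n → Set
Connected G = ∀ x y → Reach G x y

IsVC : ∀ {n} → Graph n → Subset n → Set
IsVC G C = ∀ x y → Adj G x y → x ∈ C ⊎ y ∈ C

IsMinVC : ∀ {n} → Graph n → Subset n → Set
IsMinVC G C = IsVC G C × (∀ D → IsVC G D → ∣ C ∣ ≤ ∣ D ∣)

record Subgraph {n : ℕ} (G : Graph n) : Set₁ where
  field
    verts  : Subset n
    graph  : Graph n
    edge⊆  : ∀ {x y} → Adj graph x y → Adj G x y
    endpt  : ∀ {x y} → Adj graph x y → x ∈ verts
open Subgraph public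

IsVCSub : ∀ {n} {G : Graph n} → Subgraph G → Subset n → Set
IsVCSub H C = (∀ x → x ∈ C → x ∈ verts H) × IsVC (graph H) C

IsMinVCSub : ∀ {n} {G : Graph n} → Subgraph G → Subset n → Set
IsMinVCSub H C = IsVCSub H C × (∀ D → IsVCSub H D → ∣ C ∣ ≤ ∣ D ∣)

Subdivides : ∀ {n} (G : Graph n) → Fin n → Subgraph G → Subgraph G → Set
Subdivides G u G₁ G₂ =
    (∀ x → x ∈ verts G₁ ⊎ x ∈ verts G₂)
  × (∀ x → x ∈ verts G₁ → x ∈ verts G₂ → x ≡ u)
  × u ∈ verts G₁ × u ∈ verts G₂
  × (∀ x y → Adj G x y → Adj (graph G₁) x y ⊎ Adj (graph G₂) x y)
  × (∀ x y → Adj (graph G₁) x y → Adj (graph G₂) x y → ⊥)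
  × (∃[ x ] (x ∈ verts G₁ × x ≢ u))
  × (∃[ x ] (x ∈ verts G₂ × x ≢ u))

SameEdge : ∀ {n} → Fin n → Fin n → Fin n → Fin n → Set
SameEdge a b x y = (x ≡ a × y ≡ b) ⊎ (x ≡ b × y ≡ a)

private
  sameEdge? : ∀ {n} (a b x y : Fin n) → Dec (SameEdge a b x y)
  sameEdge? a b x y = ((x ≟ a) ×-dec (y ≟ b)) ⊎-dec ((x ≟ b) ×-dec (y ≟ a))

  swap : ∀ {n} {a b x y : Fin n} → SameEdge a b x y → SameEdge a b y x
  swap (inj₁ (p , q)) = inj₂ (q , p)
  swap (inj₂ (p , q)) = inj₁ (q , p)

removeEdge : ∀ {n} → Graph n → Fin n → Fin n → Graph n
removeEdge G a b = record
  { Adj    = λ x y → Adj G x y × ¬ SameEdge a b x y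
  ; sym    = λ { (e , ne) → sym G e , λ s → ne (swap s) }
  ; irrefl = λ { (e , _) → irrefl G e }
  ; dec    = λ x y → dec G x y ×-dec ¬? (sameEdge? a b x y)
  }

VCIrreducible : ∀ {n} → Graph n → Set
VCIrreducible G =
  ∀ a b → Adj G a b →
    Σ _ λ C' → Σ _ λ C →
      IsMinVC (removeEdge G a b) C' × IsMinVC G C × ∣ C' ∣ < ∣ C ∣

VCReducible : ∀ {n} → Graph n → Set
VCReducible G = Connected G × ¬ VCIrreducible G

-- Proof idea: connectivity yields an edge e = {v, u} of G₂.  Let C' be a
-- minimum cover of G − e.  Its trace C' ∩ V(G₁) covers G₁, so it is at least
-- as large as C₁; replacing that trace by C₁ gives C₁ ∪ (C' − V(G₁)), which
-- covers G (every edge at u, e included, is covered by u ∈ C₁) and is no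
-- larger than C'.  Hence deleting e does not shrink the minimum cover.
module Submission where

open import Defs
open import Data.Nat using (suc; _+_; _≤_; s≤s; z≤n)
open import Data.Nat.Properties
  using (≤-trans; ≤-reflexive; +-suc; +-monoˡ-≤; <-irrefl; m≤n⇒m≤1+n)
open import Data.Fin using (Fin; _≟_)
open import Data.Fin.Subset using (Subset; _∈_; ∣_∣; _∪_; _∩_; _─_; inside; outside)
open import Data.Fin.Subset.Properties
  using (_∈?_; x∈p∩q⁺; x∈p∩q⁻; x∈p∪q⁺; x∈p∧x∉q⇒x∈p─q)
open import Data.Vec using ([]; _∷_)
open import Data.Product using (Σ; ∃-syntax; _×_; _,_; proj₁; proj₂)
open import Data.Sum using (_⊎_; inj₁; inj₂; [_,_]′)
import Data.Sum as Sum
open import Data.Empty using (⊥; ⊥-elim)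
open import Relation.Nullary using (¬_; yes; no)
open import Relation.Binary.PropositionalEquality
  using (_≡_; _≢_; refl; cong; trans) renaming (sym to ≡-sym)

∣p∪q∣≤∣p∣+∣q∣ : ∀ {n} (p q : Subset n) → ∣ p ∪ q ∣ ≤ ∣ p ∣ + ∣ q ∣
∣p∪q∣≤∣p∣+∣q∣ []            []            = z≤n
∣p∪q∣≤∣p∣+∣q∣ (inside ∷ p)  (inside ∷ q)  =
  s≤s (≤-trans (m≤n⇒m≤1+n (∣p∪q∣≤∣p∣+∣q∣ p q)) (≤-reflexive (≡-sym (+-suc ∣ p ∣ ∣ q ∣))))
∣p∪q∣≤∣p∣+∣q∣ (inside ∷ p)  (outside ∷ q) = s≤s (∣p∪q∣≤∣p∣+∣q∣ p q)
∣p∪q∣≤∣p∣+∣q∣ (outside ∷ p) (inside ∷ q)  =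
  ≤-trans (s≤s (∣p∪q∣≤∣p∣+∣q∣ p q)) (≤-reflexive (≡-sym (+-suc ∣ p ∣ ∣ q ∣)))
∣p∪q∣≤∣p∣+∣q∣ (outside ∷ p) (outside ∷ q) = ∣p∪q∣≤∣p∣+∣q∣ p q

∣p∩q∣+∣p─q∣≡∣p∣ : ∀ {n} (p q : Subset n) → ∣ p ∩ q ∣ + ∣ p ─ q ∣ ≡ ∣ p ∣
∣p∩q∣+∣p─q∣≡∣p∣ []            []            = refl
∣p∩q∣+∣p─q∣≡∣p∣ (inside ∷ p)  (inside ∷ q)  = cong suc (∣p∩q∣+∣p─q∣≡∣p∣ p q)
∣p∩q∣+∣p─q∣≡∣p∣ (inside ∷ p)  (outside ∷ q) =
  trans (+-suc ∣ p ∩ q ∣ ∣ p ─ q ∣) (cong suc (∣p∩q∣+∣p─q∣≡∣p∣ p q))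
∣p∩q∣+∣p─q∣≡∣p∣ (outside ∷ p) (inside ∷ q)  = ∣p∩q∣+∣p─q∣≡∣p∣ p q
∣p∩q∣+∣p─q∣≡∣p∣ (outside ∷ p) (outside ∷ q) = ∣p∩q∣+∣p─q∣≡∣p∣ p q

cover-lift⇒¬VCIrreducible : ∀ {n} (G : Graph n) {a b : Fin n} → Adj G a b →
  (∀ C' → IsVC (removeEdge G a b) C' → Σ (Subset n) λ D → IsVC G D × ∣ D ∣ ≤ ∣ C' ∣) →
  ¬ VCIrreducible G
cover-lift⇒¬VCIrreducible G ab lift irreducible
  with irreducible _ _ ab
... | C' , C , (C'-covers , _) , (_ , C-min) , C'<C
  with lift C' C'-covers
... | D , D-covers , D≤C' = <-irrefl refl (≤-trans C'<C (≤-trans (C-min D D-covers) D≤C'))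

module Articulation {n} (G : Graph n) (u : Fin n) (G₁ G₂ : Subgraph G)
  (meet  : ∀ x → x ∈ verts G₁ → x ∈ verts G₂ → x ≡ u)
  (split : ∀ x y → Adj G x y → Adj (graph G₁) x y ⊎ Adj (graph G₂) x y)
  (apart : ∀ x y → Adj (graph G₁) x y → Adj (graph G₂) x y → ⊥)
  where

  V₁ V₂ : Subset n
  V₁ = verts G₁
  V₂ = verts G₂

  E₁ E₂ : Graph n
  E₁ = graph G₁
  E₂ = graph G₂

  endptʳ : ∀ (H : Subgraph G) {x y} → Adj (graph H) x y → y ∈ verts H
  endptʳ H e = endpt H (Graph.sym (graph H) e)

  walk-enters-u-in-G₂ : ∀ {x} → Reach G x u → x ∈ V₂ → x ≢ u → ∃[ v ] Adj E₂ v u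
  walk-enters-u-in-G₂ here _ x≢u = ⊥-elim (x≢u refl)
  walk-enters-u-in-G₂ (step {x} {y} xy walk) x∈V₂ x≢u with split x y xy
  ... | inj₁ xy∈E₁ = ⊥-elim (x≢u (meet x (endpt G₁ xy∈E₁) x∈V₂))
  ... | inj₂ xy∈E₂ with y ≟ u
  ...   | yes refl = x , xy∈E₂
  ...   | no y≢u   = walk-enters-u-in-G₂ walk (endptʳ G₂ xy∈E₂) y≢u

  E₂-edge∉E₁ : ∀ {a b x y} → Adj E₂ a b → Adj E₁ x y → ¬ SameEdge a b x y
  E₂-edge∉E₁ ab xy (inj₁ (refl , refl)) = apart _ _ xy ab
  E₂-edge∉E₁ ab xy (inj₂ (refl , refl)) = apart _ _ (Graph.sym E₁ xy) ab

  cover-trace-covers-G₁ : ∀ {a b C'} → Adj E₂ a b →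
    IsVC (removeEdge G a b) C' → IsVCSub G₁ (C' ∩ V₁)
  cover-trace-covers-G₁ {C' = C'} ab C'-covers =
      (λ x x∈ → proj₂ (x∈p∩q⁻ C' V₁ x∈))
    , λ x y xy → Sum.map (λ x∈C' → x∈p∩q⁺ (x∈C' , endpt G₁ xy))
                         (λ y∈C' → x∈p∩q⁺ (y∈C' , endptʳ G₁ xy))
                         (C'-covers x y (edge⊆ G₁ xy , E₂-edge∉E₁ ab xy))

  module Glue (C₁ C' : Subset n) (u∈C₁ : u ∈ C₁) where

    glued : Subset n
    glued = C₁ ∪ (C' ─ V₁)

    C'∩V₂⊆glued : ∀ {x} → x ∈ C' → x ∈ V₂ → x ∈ glued
    C'∩V₂⊆glued {x} x∈C' x∈V₂ with x ∈? V₁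
    ... | yes x∈V₁ with meet x x∈V₁ x∈V₂
    ...   | refl = x∈p∪q⁺ (inj₁ u∈C₁)
    C'∩V₂⊆glued x∈C' _ | no x∉V₁ = x∈p∪q⁺ (inj₂ (x∈p∧x∉q⇒x∈p─q x∈C' x∉V₁))

    glued-covers : ∀ {v} → IsVC E₁ C₁ → IsVC (removeEdge G v u) C' → IsVC G glued
    glued-covers C₁-covers C'-covers x y xy with split x y xy
    ... | inj₁ xy∈E₁ = Sum.map (λ p → x∈p∪q⁺ (inj₁ p)) (λ p → x∈p∪q⁺ (inj₁ p)) (C₁-covers x y xy∈E₁)
    ... | inj₂ xy∈E₂ with x ≟ u | y ≟ u
    ...   | yes refl | _        = inj₁ (x∈p∪q⁺ (inj₁ u∈C₁))
    ...   | no _     | yes refl = inj₂ (x∈p∪q⁺ (inj₁ u∈C₁))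
    ...   | no x≢u   | no y≢u   =
      Sum.map (λ x∈C' → C'∩V₂⊆glued x∈C' (endpt G₂ xy∈E₂))
              (λ y∈C' → C'∩V₂⊆glued y∈C' (endptʳ G₂ xy∈E₂))
              (C'-covers x y (xy , [ (λ (_ , y≡u) → y≢u y≡u) , (λ (x≡u , _) → x≢u x≡u) ]′))

    glued-size : ∣ C₁ ∣ ≤ ∣ C' ∩ V₁ ∣ → ∣ glued ∣ ≤ ∣ C' ∣
    glued-size C₁≤trace = ≤-trans (∣p∪q∣≤∣p∣+∣q∣ C₁ (C' ─ V₁))
      (≤-trans (+-monoˡ-≤ ∣ C' ─ V₁ ∣ C₁≤trace) (≤-reflexive (∣p∩q∣+∣p─q∣≡∣p∣ C' V₁)))

lemma2 : ∀ {n} (G : Graph n) (u : Fin n) (G₁ G₂ : Subgraph G) →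
    Connected G → Subdivides G u G₁ G₂ →
    (∃C₁ : Σ _ λ C₁ → IsMinVCSub G₁ C₁ × u ∈ C₁) →
    VCReducible G
lemma2 G u G₁ G₂ connected (_ , meet , _ , _ , split , apart , _ , (x , x∈V₂ , x≢u))
       (C₁ , ((_ , C₁-covers) , C₁-min) , u∈C₁) =
  connected , cover-lift⇒¬VCIrreducible G (edge⊆ G₂ vu) lift
  where
  open Articulation G u G₁ G₂ meet split apart

  vu-edge : ∃[ v ] Adj E₂ v u
  vu-edge = walk-enters-u-in-G₂ (connected x u) x∈V₂ x≢u

  v : Fin _
  v = proj₁ vu-edge

  vu : Adj E₂ v u
  vu = proj₂ vu-edge

  lift : ∀ C' → IsVC (removeEdge G v u) C' → Σ _ λ D → IsVC G D × ∣ D ∣ ≤ ∣ C' ∣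
  lift C' C'-covers = glued , glued-covers C₁-covers C'-covers
                    , glued-size (C₁-min (C' ∩ V₁) (cover-trace-covers-G₁ vu C'-covers))
    where open Glue C₁ C' u∈C₁
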